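{- Let $A$ be an Abelian group with $|A|>2$. Every finite simple connected graph $H'$ is an induced subgraph of some $A$-vertex magic graph $G$.
   Context: For a non-trivial Abelian group $A$, a graph $G$ is $A$-vertex magic if there exist a labeling $l : V(G) \to A\setminus\{0\}$ and $\mu \in A$ such that $\sum_{u \in N_G(v)} l(u) = \mu$ for every $v \in V(G)$, where $N_G(v)$ is the open neighborhood of $v$. -}

module Defs where

open import Level using (Level; _⊔_)
open import Data.Nat using (ℕ; zero; suc)
open import Data.Fin using (Fin; zero; suc)
open import Data.Bool using (Bool; true; false; if_then_else_)
open import Data.Product using (Σ; ∃; _×_; _,_)
open import Relation.Binary.PropositionalEquality using (_≡_)
open import Relation.Nullary using (¬_)
open import Function.Definitions using (Injective)
open import Algebra.Bundles using (AbelianGroup)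

record Graph : Set where
  field
    n      : ℕ
    adj    : Fin n → Fin n → Bool
    sym    : ∀ u v → adj u v ≡ adj v u
    irrefl : ∀ v → adj v v ≡ false
open Graph public

data Reachable (G : Graph) : Fin (n G) → Fin (n G) → Set where
  here : ∀ {u} → Reachable G u u
  step : ∀ {u w v} → adj G u w ≡ true → Reachable G w v → Reachable G u v

Connected : Graph → Set
Connected G = ∀ u v → Reachable G u v

IsInducedSubgraph : Graph → Graph → Set
IsInducedSubgraph H G =
  Σ (Fin (n H) → Fin (n G)) λ f →
    Injective _≡_ _≡_ f × (∀ u v → adj H u v ≡ adj G (f u) (f v))

module _ {c ℓ : Level} (A : AbelianGroup c ℓ) where
  open AbelianGroup A

  sumA : ∀ {k} → (Fin k → Carrier) → Carrier
  sumA {zero}  g = ε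
  sumA {suc k} g = g zero ∙ sumA (λ i → g (suc i))

  nbrSum : (G : Graph) → (Fin (n G) → Carrier) → Fin (n G) → Carrier
  nbrSum G l v = sumA (λ u → if adj G v u then l u else ε)

  IsVertexMagic : Graph → Set (c ⊔ ℓ)
  IsVertexMagic G =
    Σ (Fin (n G) → Carrier) λ l →
      (∀ v → ¬ (l v ≈ ε)) ×
      (Σ Carrier λ μ → ∀ v → nbrSum G l v ≈ μ)

  MoreThanTwo : Set (c ⊔ ℓ)
  MoreThanTwo = Σ Carrier λ a → Σ Carrier λ b → Σ Carrier λ d →
    ¬ (a ≈ b) × ¬ (a ≈ d) × ¬ (b ≈ d)

-- Blow up every vertex of H into two non-adjacent twins with the same
-- neighbourhood, and label the twins x and x⁻¹ for some x ≠ ε.  Every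
-- neighbourhood is then a union of twin pairs, whose labels cancel, so all
-- neighbourhood sums are ε; one copy of the vertex set induces H.
module Submission where

open import Defs hiding (sym)
open import Data.Product using (Σ; _×_; _,_)
open import Algebra.Bundles using (Monoid; AbelianGroup)
open import Data.Nat using (zero; suc; _+_)
open import Data.Fin using (Fin; zero; suc; _↑ˡ_; splitAt)
open import Data.Fin.Properties using (↑ˡ-injective)
open import Data.Sum using (_⊎_; inj₁; inj₂; [_,_])
open import Data.Sum.Properties using ([,]-map)
open import Data.Bool using (true; false; if_then_else_)
open import Data.Vec.Functional using (Vector; _++_; replicate)
open import Data.Vec.Functional.Properties using (lookup-++ˡ)
open import Relation.Binary.PropositionalEquality as ≡ using (_≡_)
open import Relation.Nullary using (¬_)
import Algebra.Properties.Monoid.Sum as MonoidSum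
import Algebra.Properties.CommutativeMonoid.Sum as CommutativeMonoidSum
import Algebra.Properties.Group as GroupProperties
import Relation.Binary.Reasoning.Setoid as SetoidReasoning

module _ {a ℓ} (M : Monoid a ℓ) where
  open Monoid M
  open MonoidSum M using (sum; sum-cong-≗)

  sum-++ : ∀ {m n} (xs : Vector Carrier m) (ys : Vector Carrier n) →
           sum (xs ++ ys) ≈ sum xs ∙ sum ys
  sum-++ {zero}  xs ys = sym (identityˡ _)
  sum-++ {suc m} xs ys = trans (∙-congˡ tail-sum) (sym (assoc _ _ _))
    where
    tail-sum : sum (λ i → (xs ++ ys) (suc i)) ≈ sum (λ i → xs (suc i)) ∙ sum ys
    tail-sum = trans (reflexive (sum-cong-≗ (λ i → [,]-map (splitAt m i))))
                     (sum-++ (λ i → xs (suc i)) ys)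

-- The twins i ↑ˡ m and m ↑ʳ i of a vertex i are both sent back to i.
untwin : ∀ {m} → Fin (m + m) → Fin m
untwin = (λ i → i) ++ (λ i → i)

untwin-↑ˡ : ∀ {m} (i : Fin m) → untwin (i ↑ˡ m) ≡ i
untwin-↑ˡ = lookup-++ˡ (λ i → i) (λ i → i)

twins : Graph → Graph
twins H = record
  { n      = n H + n H
  ; adj    = λ i j → adj H (untwin i) (untwin j)
  ; sym    = λ i j → Graph.sym H (untwin i) (untwin j)
  ; irrefl = λ i → irrefl H (untwin i)
  }

twins-induced : (H : Graph) → IsInducedSubgraph H (twins H)
twins-induced H =
  (_↑ˡ n H) , ↑ˡ-injective (n H) _ _ ,
  λ u v → ≡.sym (≡.cong₂ (adj H) (untwin-↑ˡ u) (untwin-↑ˡ v))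

module _ {c ℓ} (A : AbelianGroup c ℓ) where
  open AbelianGroup A
  open GroupProperties group using (x∙y⁻¹≈ε⇒x≈y; ⁻¹-injective; ε⁻¹≈ε)
  open MonoidSum monoid using (sum; sum-cong-≗; sum-cong-≋; sum-replicate-zero)
  open CommutativeMonoidSum commutativeMonoid using (∑-distrib-+)
  open SetoidReasoning setoid

  sumA≡sum : ∀ {k} (g : Vector Carrier k) → sumA A g ≡ sum g
  sumA≡sum {zero}  g = ≡.refl
  sumA≡sum {suc k} g = ≡.cong (g zero ∙_) (sumA≡sum (λ i → g (suc i)))

  x≉y⇒x∙y⁻¹≉ε : ∀ {x y} → ¬ (x ≈ y) → ¬ (x ∙ y ⁻¹ ≈ ε)
  x≉y⇒x∙y⁻¹≉ε x≉y e = x≉y (x∙y⁻¹≈ε⇒x≈y _ _ e)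

  x≉ε⇒x⁻¹≉ε : ∀ {x} → ¬ (x ≈ ε) → ¬ (x ⁻¹ ≈ ε)
  x≉ε⇒x⁻¹≉ε x≉ε e = x≉ε (⁻¹-injective (trans e (sym ε⁻¹≈ε)))

  twinLabelling : (H : Graph) → Carrier → Fin (n (twins H)) → Carrier
  twinLabelling H x = replicate (n H) x ++ replicate (n H) (x ⁻¹)

  twinLabelling-nonzero : ∀ H {x} → ¬ (x ≈ ε) → ∀ v → ¬ (twinLabelling H x v ≈ ε)
  twinLabelling-nonzero H x≉ε v with splitAt (n H) v
  ... | inj₁ _ = x≉ε
  ... | inj₂ _ = x≉ε⇒x⁻¹≉ε x≉ε

  twins-nbrSum : ∀ H x v → nbrSum A (twins H) (twinLabelling H x) v ≈ ε
  twins-nbrSum H x v = begin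
    nbrSum A (twins H) (twinLabelling H x) v
      ≡⟨ sumA≡sum (λ i → if adj (twins H) v i then twinLabelling H x i else ε) ⟩
    sum (λ i → if adj (twins H) v i then twinLabelling H x i else ε)
      ≡⟨ sum-cong-≗ (λ i → nbr-term (splitAt (n H) i)) ⟩
    sum (neighbours x ++ neighbours (x ⁻¹))
      ≈⟨ sum-++ monoid (neighbours x) (neighbours (x ⁻¹)) ⟩
    sum (neighbours x) ∙ sum (neighbours (x ⁻¹))
      ≈⟨ ∑-distrib-+ (neighbours x) (neighbours (x ⁻¹)) ⟨
    sum (λ j → neighbours x j ∙ neighbours (x ⁻¹) j)
      ≈⟨ sum-cong-≋ (λ j → cancel (adj H (untwin v) j)) ⟩
    sum (replicate (n H) ε)
      ≈⟨ sum-replicate-zero (n H) ⟩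
    ε ∎
    where
    neighbours : Carrier → Vector Carrier (n H)
    neighbours y j = if adj H (untwin v) j then y else ε

    -- untwin, twinLabelling and _++_ all case on splitAt (n H) i.
    nbr-term : (s : Fin (n H) ⊎ Fin (n H)) →
      (if adj H (untwin v) ([ (λ j → j) , (λ j → j) ] s)
         then [ (λ _ → x) , (λ _ → x ⁻¹) ] s else ε)
      ≡ [ neighbours x , neighbours (x ⁻¹) ] s
    nbr-term (inj₁ _) = ≡.refl
    nbr-term (inj₂ _) = ≡.refl

    cancel : ∀ b → (if b then x else ε) ∙ (if b then x ⁻¹ else ε) ≈ ε
    cancel true  = inverseʳ x
    cancel false = identityˡ ε

  twins-vertexMagic : ∀ H {x} → ¬ (x ≈ ε) → IsVertexMagic A (twins H)
  twins-vertexMagic H {x} x≉ε =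
    twinLabelling H x , twinLabelling-nonzero H x≉ε , ε , twins-nbrSum H x

mainTheorem11 : ∀ {c ℓ} (A : AbelianGroup c ℓ) → MoreThanTwo A →
    (H : Graph) → Connected H →
    Σ Graph λ G → IsVertexMagic A G × IsInducedSubgraph H G
mainTheorem11 A (x , y , _ , x≉y , _ , _) H _ =
  twins H , twins-vertexMagic A H (x≉y⇒x∙y⁻¹≉ε A x≉y) , twins-induced H
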